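{- Let $\Pi$ be a linear $m$-scheme on $S\subseteq V$. Let $W\subseteq W'$ be linear subspaces of $V$ and $d=\dim W'-\dim W$. Suppose $W$ is $(\Pi,k)$-constructible for some $k\in[m]$, and $W'\subseteq W+t(\mathbb{F}S)$ for some $t\in\mathbb{N}$ with $k+2dt\le m$. Then there exists $x\in S^{dt}$ such that $W'$ is $(\Pi_x,k+dt)$-constructible.
   Context: $V$ is a finite-dimensional vector space over a finite field $\mathbb{F}$. $\mathcal{M}_{k,k'}$ is the set of maps $V^k\to V^{k'}$, $(x_1,\dots,x_k)\mapsto(\sum_i c_{i,1}x_i,\dots,\sum_i c_{i,k'}x_i)$, $c_{i,j}\in\mathbb{F}$. A linear $m$-scheme on $S$ is $\Pi=\{\Pi^{(1)},\dots,\Pi^{(m)}\}$ with $\Pi^{(k)}$ a partition of $S^k$ such that for all $k,k'\in[m]$, $B\in\Pi^{(k)}$, $B'\in\Pi^{(k')}$, $\tau\in\mathcal{M}_{k,k'}$: (P1) $\tau(B)=B'$ or $\tau(B)\cap B'=\emptyset$; (P2) $\#\{x\in B:\tau(x)=y\}$ is constant for $y\in B'$. For $x\in S^j$ ($j<m$), $\Pi_x$ is the linear $(m-j)$-scheme with $y,z\in S^k$ in the same block of $\Pi_x^{(k)}$ iff $(x,y),(x,z)$ are in the same block of $\Pi^{(j+k)}$ (for $j=0$, $\Pi_x=\Pi$). $\mathcal{S}_{\Pi,k}=\{\tau(B):B\in\Pi^{(k)},\tau\in\mathcal{M}_{k,1}\}$; a subset of $V$ is $(\Pi,k)$-constructible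 if it is a union of members of $\mathcal{S}_{\Pi,k}$. $\mathbb{F}S=\{ca:c\in\mathbb{F},a\in S\}$ and $t(\mathbb{F}S)$ is the $t$-fold sumset $\mathbb{F}S+\dots+\mathbb{F}S$. -}

module Defs where

open import Level using (0ℓ)
open import Data.Nat as ℕ using (ℕ; zero; suc)
open import Data.Product using (Σ; ∃; ∃-syntax; _×_; _,_; proj₁; proj₂)
open import Data.Sum using (_⊎_)
open import Data.List as List using (List; []; _∷_; length; filter; concatMap)
open import Data.List.Membership.Propositional using (_∈_)
open import Data.List.Relation.Unary.Any using (Any)
open import Data.List.Relation.Unary.All as ListAll using ()
open import Data.List.Relation.Unary.Unique.Propositional using (Unique)
open import Data.Vec as Vec using (Vec; []; _∷_; _++_; zipWith; replicate; lookup; tabulate; foldr′)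
open import Data.Vec.Relation.Unary.All as VAll using (All; all?)
import Data.Vec.Properties as VecP
open import Data.Fin using (Fin)
open import Algebra.Structures using (IsCommutativeRing)
open import Relation.Binary.PropositionalEquality using (_≡_)
open import Relation.Binary.Definitions using (DecidableEquality)
open import Relation.Nullary using (¬_; Dec)
open import Relation.Nullary.Decidable using (_×-dec_)
open import Function.Bundles using (_⇔_)

record FiniteField : Set₁ where
  infixl 6 _+_
  infixl 7 _*_
  field
    Carrier  : Set
    _+_ _*_  : Carrier → Carrier → Carrier
    -_       : Carrier → Carrier
    0# 1#    : Carrier
    isCommutativeRing : IsCommutativeRing _≡_ _+_ _*_ -_ 0# 1#
    0≢1      : ¬ (0# ≡ 1#)
    inverse  : ∀ x → ¬ (x ≡ 0#) → ∃[ y ] (x * y ≡ 1#)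
    _≟_      : DecidableEquality Carrier
    elements : List Carrier
    complete : ∀ x → x ∈ elements
    unique   : Unique elements

allVecs : ∀ {A : Set} (k : ℕ) → List A → List (Vec A k)
allVecs zero    xs = [] ∷ []
allVecs (suc k) xs = concatMap (λ a → List.map (a ∷_) (allVecs k xs)) xs

module Scheme (F : FiniteField) (n : ℕ) where
  open FiniteField F public using (Carrier; 0#; 1#)
  open FiniteField F using (_+_; _*_; _≟_; elements)

  V : Set
  V = Vec Carrier n

  0V : V
  0V = replicate n 0#

  infixl 6 _⊕_
  _⊕_ : V → V → V
  _⊕_ = zipWith _+_

  _·_ : Carrier → V → V
  c · v = Vec.map (c *_) v

  lincomb : ∀ {r} → Vec Carrier r → Vec V r → V
  lincomb cs vs = foldr′ _⊕_ 0V (zipWith _·_ cs vs)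

  -- all elements of V^k (each exactly once)
  allV^ : (k : ℕ) → List (Vec V k)
  allV^ k = allVecs k (allVecs n elements)

  _≟V^_ : ∀ {k} → DecidableEquality (Vec V k)
  _≟V^_ = VecP.≡-dec (VecP.≡-dec _≟_)

  count : ∀ {k} {P : Vec V k → Set} → (∀ x → Dec (P x)) → ℕ
  count {k} P? = length (filter P? (allV^ k))

  -- Maps in M_{k,k'}: coefficient matrix c (c i j = c_{i,j}), and
  -- τ(x_1..x_k) = (Σ_i c_{i,1} x_i, …, Σ_i c_{i,k'} x_i).

  Coeff : ℕ → ℕ → Set
  Coeff k k' = Vec (Vec Carrier k') k

  apply : ∀ {k k'} → Coeff k k' → Vec V k → Vec V k'
  apply {k} {k'} c x =
    tabulate (λ (j : Fin k') → lincomb (tabulate (λ (i : Fin k) → lookup (lookup c i) j)) x)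

  -- Partitions of S^k, k ∈ [m], given by block labels:
  -- x, y ∈ S^k lie in the same block of Π^(k) iff lab k x ≡ lab k y.
  -- A block is presented by a representative b ∈ S^k.

  Labels : Set
  Labels = (k : ℕ) → Vec V k → ℕ

  InBlock : (S : V → Set) → Labels → ∀ {k} → Vec V k → Vec V k → Set
  InBlock S lab {k} b x = All S x × lab k x ≡ lab k b

  inBlock? : (S : V → Set) → (∀ v → Dec (S v)) → (lab : Labels) →
             ∀ {k} (b : Vec V k) → ∀ x → Dec (InBlock S lab b x)
  inBlock? S S? lab {k} b x = all? S? x ×-dec (lab k x ℕ.≟ lab k b)

  fibre? : (S : V → Set) → (∀ v → Dec (S v)) → (lab : Labels) →
           ∀ {k k'} (b : Vec V k) (c : Coeff k k') (y : Vec V k') →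
           ∀ x → Dec (InBlock S lab b x × apply c x ≡ y)
  fibre? S S? lab b c y x = inBlock? S S? lab b x ×-dec (apply c x ≟V^ y)

  ImageEq : (S : V → Set) → Labels → ∀ {k k'} → Vec V k → Coeff k k' → Vec V k' → Set
  ImageEq S lab b c b' =
    ∀ y → (∃[ x ] (InBlock S lab b x × apply c x ≡ y)) ⇔ InBlock S lab b' y

  ImageDisjoint : (S : V → Set) → Labels → ∀ {k k'} → Vec V k → Coeff k k' → Vec V k' → Set
  ImageDisjoint S lab b c b' = ∀ x → InBlock S lab b x → ¬ InBlock S lab b' (apply c x)

  IsLinearScheme : (S : V → Set) → (∀ v → Dec (S v)) → (m : ℕ) → Labels → Set
  IsLinearScheme S S? m lab =
    ∀ (k k' : ℕ) → 1 ℕ.≤ k → k ℕ.≤ m → 1 ℕ.≤ k' → k' ℕ.≤ m →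
    (b : Vec V k) → All S b → (b' : Vec V k') → All S b' → (c : Coeff k k') →
      (ImageEq S lab b c b' ⊎ ImageDisjoint S lab b c b')
    × (∀ y y' → InBlock S lab b' y → InBlock S lab b' y' →
         count (fibre? S S? lab b c y) ≡ count (fibre? S S? lab b c y'))

  -- Π_x for x ∈ S^j: (Π_x)^(k) relates y, z iff (x,y), (x,z) are
  -- in the same block of Π^(j+k).
  restrict : Labels → ∀ {j} → Vec V j → Labels
  restrict lab {j} x k y = lab (j ℕ.+ k) (x ++ y)

  -- A ⊆ V is (Π,k)-constructible: A is the union of a (finite) family of
  -- members τ(B) of S_{Π,k}, B ∈ Π^(k) (representative b ∈ S^k), τ ∈ M_{k,1}.
  InImage : (S : V → Set) → Labels → ∀ {k} → Vec V k → Coeff k 1 → V → Set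
  InImage S lab b c v = ∃[ x ] (InBlock S lab b x × apply c x ≡ v ∷ [])

  Constructible : (S : V → Set) → Labels → (k : ℕ) → (V → Set) → Set
  Constructible S lab k A =
    Σ (List (Vec V k × Coeff k 1)) λ L →
        ListAll.All (λ p → All S (proj₁ p)) L
      × (∀ v → A v ⇔ Any (λ p → InImage S lab (proj₁ p) (proj₂ p) v) L)

  IsSubspace : (V → Set) → Set
  IsSubspace W = W 0V × (∀ u v → W u → W v → W (u ⊕ v)) × (∀ c v → W v → W (c · v))

  InSpan : ∀ {r} → Vec V r → V → Set
  InSpan {r} bs v = ∃[ cs ] (v ≡ lincomb {r} cs bs)

  LinIndep : ∀ {r} → Vec V r → Set
  LinIndep {r} bs = ∀ (cs : Vec Carrier r) → lincomb cs bs ≡ 0V → All (_≡ 0#) cs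

  HasDim : (V → Set) → ℕ → Set
  HasDim W r = Σ (Vec V r) λ bs → LinIndep bs × (∀ v → W v ⇔ InSpan bs v)

  -- v ∈ t(𝔽S) = 𝔽S + … + 𝔽S (t summands; {0} for t = 0)
  InSumset : (S : V → Set) → ℕ → V → Set
  InSumset S t v = Σ (Vec Carrier t) λ cs → Σ (Vec V t) λ s → All S s × v ≡ lincomb cs s

  InSubspacePlusSumset : (V → Set) → (S : V → Set) → ℕ → V → Set
  InSubspacePlusSumset W S t v = ∃[ w ] ∃[ u ] (W w × InSumset S t u × v ≡ w ⊕ u)

module Submission where

-- Extend a basis of W by d = dim W' − dim W vectors g₁ … g_d of W' and write gᵢ = wᵢ + Σⱼ aᵢⱼ sᵢⱼ
-- with wᵢ ∈ W, sᵢⱼ ∈ S. For x = (sᵢⱼ) ∈ S^{dt}, W' is the finite union over λ ∈ 𝔽^d of the translates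
-- W + Σᵢⱼ λᵢ aᵢⱼ sᵢⱼ, so it suffices that each translate τ(B) + μ·x of a member of S_{Π,k} is
-- (Π_x, k+dt)-constructible. It is the union, over y₀ ∈ B, of the images of the Π_x-blocks of y₀x under
-- (y, z) ↦ τ(y) + μ·z, because every Π_x-block of y₀x consists of tuples yx with y in the block of y₀.
-- To see this, view blocks of Π_x inside Π^{2dt+k}: the linear map (p, y, z) ↦ (p, y, p) fixes x y₀ x,
-- so by (P1) it maps the block of x y₀ x onto itself, and every x y z in that block has the form
-- (p, y', p), i.e. z = x; projecting to the middle coordinates maps the block into the block of y₀.
-- This is where k + 2dt ≤ m is needed.

open import Defs
open import Level using (0ℓ)
open import Function.Base using (_∘_)
open import Function.Bundles using (_⇔_; Equivalence; mk⇔)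
import Function.Properties.Equivalence as ⇔
open import Relation.Binary.PropositionalEquality
  using (_≡_; refl; sym; trans; cong; cong₂; subst; isEquivalence; module ≡-Reasoning)
open import Relation.Nullary using (¬_; Dec; yes; no)
open import Data.Empty using (⊥-elim)
open import Data.Sum using (inj₁; inj₂)
open import Data.Product using (Σ; ∃-syntax; _×_; _,_; proj₁; proj₂)
open import Data.Nat using (ℕ; zero; suc; _+_; _*_; _∸_; _≤_; z≤n; s≤s)
open import Data.Nat.Properties using (m+n∸n≡m; ∸-monoˡ-≤; ≤-trans; m≤m+n; m≤n+m)
open import Data.Nat.Tactic.RingSolver using (solve-∀)
open import Data.Fin using (Fin; zero; suc; _↑ˡ_; _↑ʳ_)
open import Data.Vec as Vec using (Vec; []; _∷_; _++_; zipWith; replicate; lookup; tabulate)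
open import Data.Vec.Properties
  using (≡-dec; ∷-injectiveˡ; ++-injective; ++-injectiveʳ; lookup-++ˡ; lookup-++ʳ;
         lookup∘tabulate; tabulate∘lookup; tabulate-∘; tabulate-cong; tabulate-allFin;
         zipWith-assoc; zipWith-comm; zipWith-identityˡ; zipWith-identityʳ;
         zipWith-inverseˡ; zipWith-inverseʳ;
         map-++; map-cong; map-∘; map-id; map-const; map-replicate)
open import Data.Vec.Relation.Unary.All as All using (All; []; _∷_)
open import Data.Vec.Relation.Unary.All.Properties using (++⁺)
open import Data.List as List using (List)
open import Data.List.Relation.Unary.All as ListAll using ()
open import Data.List.Relation.Unary.All.Properties as ListAllP using ()
open import Data.List.Relation.Unary.Any as Any using (Any; here; there; any?)
open import Data.List.Relation.Unary.Any.Properties as AnyP using ()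
open import Data.List.Membership.Propositional using (_∈_; lose; find)
open import Data.List.Membership.Propositional.Properties
  using (∈-concatMap⁺; ∈-map⁺; ∈-filter⁺; ∈-filter⁻)
open import Algebra.Structures using (IsCommutativeRing)
open import Algebra.Bundles using (CommutativeRing; AbelianGroup)
import Algebra.Properties.Ring as RingProperties
import Algebra.Properties.CommutativeSemigroup as CommutativeSemigroupProperties
import Algebra.Properties.Group as GroupProperties

allVecs-complete : ∀ {A : Set} {xs : List A} k (as : Vec A k) → All (_∈ xs) as → as ∈ allVecs k xs
allVecs-complete zero    []       []       = here refl
allVecs-complete (suc k) (a ∷ as) (p ∷ ps) =
  ∈-concatMap⁺ _ (lose p (∈-map⁺ (a ∷_) (allVecs-complete k as ps)))

All-replicate : ∀ {A : Set} {P : A → Set} {a} k → P a → All P (replicate k a)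
All-replicate zero    pa = []
All-replicate (suc k) pa = pa ∷ All-replicate k pa

All-padRight : ∀ {A : Set} {P : A → Set} {a j k} (j≤k : j ≤ k) → P a → {xs : Vec A j} → All P xs →
               All P (Vec.padRight j≤k a xs)
All-padRight {k = k} z≤n pa []        = All-replicate k pa
All-padRight (s≤s j≤k) pa (px ∷ pxs) = px ∷ All-padRight j≤k pa pxs

map-lookup-allFin : ∀ {A : Set} {k} (xs : Vec A k) → Vec.map (lookup xs) (Vec.allFin k) ≡ xs
map-lookup-allFin xs = trans (sym (tabulate-allFin (lookup xs))) (tabulate∘lookup xs)

map-lookup-↑ˡ : ∀ {A : Set} {k l p} (xs : Vec A k) (ys : Vec A l) (is : Vec (Fin k) p) →
                Vec.map (lookup (xs ++ ys)) (Vec.map (_↑ˡ l) is) ≡ Vec.map (lookup xs) is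
map-lookup-↑ˡ xs ys is = trans (sym (map-∘ _ _ is)) (map-cong (lookup-++ˡ xs ys) is)

map-lookup-↑ʳ : ∀ {A : Set} {k l p} (xs : Vec A k) (ys : Vec A l) (is : Vec (Fin l) p) →
                Vec.map (lookup (xs ++ ys)) (Vec.map (k ↑ʳ_) is) ≡ Vec.map (lookup ys) is
map-lookup-↑ʳ xs ys is = trans (sym (map-∘ _ _ is)) (map-cong (lookup-++ʳ xs ys) is)

module Coordinatewise (F : FiniteField) where
  open FiniteField F using (Carrier; 0#; 1#; isCommutativeRing)
    renaming (_+_ to _+ᶠ_; _*_ to _*ᶠ_; -_ to -ᶠ_)
  open IsCommutativeRing isCommutativeRing
    using (+-assoc; +-comm; +-identityˡ; +-identityʳ; -‿inverseˡ; -‿inverseʳ;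
           *-assoc; *-identityˡ; zeroˡ; zeroʳ; distribˡ; distribʳ)

  𝔽-commutativeRing : CommutativeRing 0ℓ 0ℓ
  𝔽-commutativeRing = record { isCommutativeRing = isCommutativeRing }

  open RingProperties (CommutativeRing.ring 𝔽-commutativeRing) using (-1*x≈-x)
  private module Fᵐ {m : ℕ} = Scheme F m
  open Fᵐ using (_⊕_; _·_; 0V)

  ⊖_ : ∀ {m} → Vec Carrier m → Vec Carrier m
  ⊖ v = (-ᶠ 1#) · v

  Fᵐ-abelianGroup : ℕ → AbelianGroup 0ℓ 0ℓ
  Fᵐ-abelianGroup m = record
    { Carrier = Vec Carrier m
    ; _≈_ = _≡_
    ; _∙_ = _⊕_
    ; ε = 0V
    ; _⁻¹ = ⊖_
    ; isAbelianGroup = record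
      { isGroup = record
        { isMonoid = record
          { isSemigroup = record
            { isMagma = record { isEquivalence = isEquivalence ; ∙-cong = cong₂ _⊕_ }
            ; assoc = zipWith-assoc +-assoc }
          ; identity = zipWith-identityˡ +-identityˡ , zipWith-identityʳ +-identityʳ }
        ; inverse = zipWith-inverseˡ (λ x → trans (cong (_+ᶠ x) (-1*x≈-x x)) (-‿inverseˡ x))
                  , zipWith-inverseʳ (λ x → trans (cong (x +ᶠ_) (-1*x≈-x x)) (-‿inverseʳ x))
        ; ⁻¹-cong = cong ⊖_ }
      ; comm = zipWith-comm +-comm }
    }

  open module Groupᵐ {m} = AbelianGroup (Fᵐ-abelianGroup m) public
    using () renaming (assoc to ⊕-assoc; comm to ⊕-comm;
                       identityˡ to ⊕-identityˡ; identityʳ to ⊕-identityʳ; inverseʳ to ⊕-inverseʳ)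

  ⊕-interchange : ∀ {m} (a b c d : Vec Carrier m) → (a ⊕ b) ⊕ (c ⊕ d) ≡ (a ⊕ c) ⊕ (b ⊕ d)
  ⊕-interchange {m} = CommutativeSemigroupProperties.interchange
    (AbelianGroup.commutativeSemigroup (Fᵐ-abelianGroup m))

  ⊕≡0⇒≡⊖ : ∀ {m} (u v : Vec Carrier m) → u ⊕ v ≡ 0V → u ≡ ⊖ v
  ⊕≡0⇒≡⊖ {m} = GroupProperties.inverseˡ-unique (AbelianGroup.group (Fᵐ-abelianGroup m))

  ·-distribˡ : ∀ {m} c (u v : Vec Carrier m) → c · (u ⊕ v) ≡ c · u ⊕ c · v
  ·-distribˡ c []      []      = refl
  ·-distribˡ c (a ∷ u) (b ∷ v) = cong₂ _∷_ (distribˡ c a b) (·-distribˡ c u v)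

  ·-distribʳ : ∀ {m} a b (v : Vec Carrier m) → (a +ᶠ b) · v ≡ a · v ⊕ b · v
  ·-distribʳ a b []      = refl
  ·-distribʳ a b (x ∷ v) = cong₂ _∷_ (distribʳ x a b) (·-distribʳ a b v)

  ·-assoc : ∀ {m} a b (v : Vec Carrier m) → (a *ᶠ b) · v ≡ a · (b · v)
  ·-assoc a b v = trans (map-cong (*-assoc a b) v) (map-∘ (a *ᶠ_) (b *ᶠ_) v)

  ·-identityˡ : ∀ {m} (v : Vec Carrier m) → 1# · v ≡ v
  ·-identityˡ v = trans (map-cong *-identityˡ v) (map-id v)

  ·-zeroˡ : ∀ {m} (v : Vec Carrier m) → 0# · v ≡ 0V
  ·-zeroˡ v = trans (map-cong zeroˡ v) (map-const v 0#)

  ·-zeroʳ : ∀ {m} c → c · 0V {m} ≡ 0V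
  ·-zeroʳ {m} c = trans (map-replicate (c *ᶠ_) 0# m) (cong (replicate m) (zeroʳ c))

module LinearCombinations (F : FiniteField) (n : ℕ) where
  open Scheme F n
  open FiniteField F using (elements; complete) renaming (_+_ to _+ᶠ_; _*_ to _*ᶠ_; _≟_ to _≟ᶠ_)
  open Coordinatewise F
  open ≡-Reasoning

  InTranslate : (V → Set) → V → V → Set
  InTranslate W u v = ∃[ w ] (W w × v ≡ w ⊕ u)

  ∈-allVecs : ∀ {k} (cs : Vec Carrier k) → cs ∈ allVecs k elements
  ∈-allVecs cs = allVecs-complete _ cs (All.universal complete cs)

  ∈-allV^ : ∀ {k} (y : Vec V k) → y ∈ allV^ k
  ∈-allV^ y = allVecs-complete _ y (All.universal ∈-allVecs y)

  lincomb-zeros : ∀ {r} (vs : Vec V r) → lincomb (replicate r 0#) vs ≡ 0V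
  lincomb-zeros []       = refl
  lincomb-zeros (v ∷ vs) = begin
    0# · v ⊕ lincomb (replicate _ 0#) vs ≡⟨ cong₂ _⊕_ (·-zeroˡ v) (lincomb-zeros vs) ⟩
    0V ⊕ 0V                              ≡⟨ ⊕-identityˡ 0V ⟩
    0V                                   ∎

  lincomb-0∷ : ∀ {r} (cs : Vec Carrier r) v vs → lincomb (0# ∷ cs) (v ∷ vs) ≡ lincomb cs vs
  lincomb-0∷ cs v vs = trans (cong (_⊕ lincomb cs vs) (·-zeroˡ v)) (⊕-identityˡ _)

  lincomb-+ : ∀ {r} (cs ds : Vec Carrier r) (vs : Vec V r) →
              lincomb (zipWith _+ᶠ_ cs ds) vs ≡ lincomb cs vs ⊕ lincomb ds vs
  lincomb-+ []       []       []       = sym (⊕-identityˡ 0V)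
  lincomb-+ (c ∷ cs) (d ∷ ds) (v ∷ vs) = begin
    (c +ᶠ d) · v ⊕ lincomb (zipWith _+ᶠ_ cs ds) vs
      ≡⟨ cong₂ _⊕_ (·-distribʳ c d v) (lincomb-+ cs ds vs) ⟩
    (c · v ⊕ d · v) ⊕ (lincomb cs vs ⊕ lincomb ds vs)
      ≡⟨ ⊕-interchange (c · v) (d · v) _ _ ⟩
    (c · v ⊕ lincomb cs vs) ⊕ (d · v ⊕ lincomb ds vs) ∎

  lincomb-* : ∀ {r} a (cs : Vec Carrier r) (vs : Vec V r) →
              lincomb (Vec.map (a *ᶠ_) cs) vs ≡ a · lincomb cs vs
  lincomb-* a []       []       = sym (·-zeroʳ a)
  lincomb-* a (c ∷ cs) (v ∷ vs) = begin
    (a *ᶠ c) · v ⊕ lincomb (Vec.map (a *ᶠ_) cs) vs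
      ≡⟨ cong₂ _⊕_ (·-assoc a c v) (lincomb-* a cs vs) ⟩
    a · (c · v) ⊕ a · lincomb cs vs
      ≡⟨ sym (·-distribˡ a _ _) ⟩
    a · (c · v ⊕ lincomb cs vs) ∎

  lincomb-++ : ∀ {r s} (cs : Vec Carrier r) (ds : Vec Carrier s) (vs : Vec V r) (ws : Vec V s) →
               lincomb (cs ++ ds) (vs ++ ws) ≡ lincomb cs vs ⊕ lincomb ds ws
  lincomb-++ []       ds []       ws = sym (⊕-identityˡ _)
  lincomb-++ (c ∷ cs) ds (v ∷ vs) ws =
    trans (cong (c · v ⊕_) (lincomb-++ cs ds vs ws)) (sym (⊕-assoc _ _ _))

  InSpan-0V : ∀ {r} (E : Vec V r) → InSpan E 0V
  InSpan-0V E = replicate _ 0# , sym (lincomb-zeros E)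

  InSpan-⊕ : ∀ {r} (E : Vec V r) {u v} → InSpan E u → InSpan E v → InSpan E (u ⊕ v)
  InSpan-⊕ E (cs , eu) (ds , ev) = zipWith _+ᶠ_ cs ds , trans (cong₂ _⊕_ eu ev) (sym (lincomb-+ cs ds E))

  InSpan-· : ∀ {r} (E : Vec V r) a {v} → InSpan E v → InSpan E (a · v)
  InSpan-· E a (cs , ev) = Vec.map (a *ᶠ_) cs , trans (cong (a ·_) ev) (sym (lincomb-* a cs E))

  InSpan-lincomb : ∀ {r s} (E : Vec V r) (cs : Vec Carrier s) {bs : Vec V s} → All (InSpan E) bs →
                   InSpan E (lincomb cs bs)
  InSpan-lincomb E []       []       = InSpan-0V E
  InSpan-lincomb E (c ∷ cs) (p ∷ ps) = InSpan-⊕ E (InSpan-· E c p) (InSpan-lincomb E cs ps)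

  InSpan-∷ : ∀ {r} (E : Vec V r) b {v} → InSpan E v → InSpan (b ∷ E) v
  InSpan-∷ E b (cs , ev) = 0# ∷ cs , trans ev (sym (lincomb-0∷ cs b E))

  InSpan-head : ∀ {r} (E : Vec V r) b → InSpan (b ∷ E) b
  InSpan-head E b = 1# ∷ replicate _ 0# ,
    sym (trans (cong₂ _⊕_ (·-identityˡ b) (lincomb-zeros E)) (⊕-identityʳ b))

  InSpan-self : ∀ {r} (E : Vec V r) → All (InSpan E) E
  InSpan-self []      = []
  InSpan-self (b ∷ E) = InSpan-head E b ∷ All.map (InSpan-∷ E b) (InSpan-self E)

  InSpan? : ∀ {r} (E : Vec V r) v → Dec (InSpan E v)
  InSpan? E v with any? (λ cs → ≡-dec _≟ᶠ_ v (lincomb cs E)) (allVecs _ elements)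
  ... | yes p = let (cs , _ , e) = find p in yes (cs , e)
  ... | no ¬p = no λ (cs , e) → ¬p (lose (∈-allVecs cs) e)

module Dimension (F : FiniteField) (n : ℕ) where
  open Scheme F n
  open FiniteField F using (0≢1; inverse; isCommutativeRing)
    renaming (_+_ to _+ᶠ_; _*_ to _*ᶠ_; -_ to -ᶠ_; _≟_ to _≟ᶠ_)
  open IsCommutativeRing isCommutativeRing using (*-assoc; *-comm; *-identityʳ; -‿inverseʳ)
  open Coordinatewise F
  open RingProperties (CommutativeRing.ring 𝔽-commutativeRing) using (-‿distribˡ-*)
  open LinearCombinations F n
  open ≡-Reasoning

  cancel-coefficient : ∀ {a a⁻¹} → a *ᶠ a⁻¹ ≡ 1# → ∀ b → b +ᶠ (-ᶠ (b *ᶠ a⁻¹)) *ᶠ a ≡ 0#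
  cancel-coefficient {a} {a⁻¹} aa⁻¹ b = begin
    b +ᶠ (-ᶠ (b *ᶠ a⁻¹)) *ᶠ a
      ≡⟨ cong (b +ᶠ_) (sym (-‿distribˡ-* (b *ᶠ a⁻¹) a)) ⟩
    b +ᶠ -ᶠ ((b *ᶠ a⁻¹) *ᶠ a)
      ≡⟨ cong (λ z → b +ᶠ -ᶠ z) (*-assoc b a⁻¹ a) ⟩
    b +ᶠ -ᶠ (b *ᶠ (a⁻¹ *ᶠ a))
      ≡⟨ cong (λ z → b +ᶠ -ᶠ (b *ᶠ z)) (trans (*-comm a⁻¹ a) aa⁻¹) ⟩
    b +ᶠ -ᶠ (b *ᶠ 1#)
      ≡⟨ cong (λ z → b +ᶠ -ᶠ z) (*-identityʳ b) ⟩
    b +ᶠ -ᶠ b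
      ≡⟨ -‿inverseʳ b ⟩
    0# ∎

  clear-generator : ∀ {q w} {ws : Vec V q} {a a⁻¹ rs v} → a *ᶠ a⁻¹ ≡ 1# → v ≡ lincomb (a ∷ rs) (w ∷ ws) →
                    ∀ {u} → InSpan (w ∷ ws) u → ∃[ β ] InSpan ws (u ⊕ β · v)
  clear-generator {w = w} {ws} {a} {a⁻¹} {rs} {v} aa⁻¹ ev {u} (b ∷ qs , eu) = β , cs , (begin
    u ⊕ β · v
      ≡⟨ cong₂ (λ x y → x ⊕ β · y) eu ev ⟩
    lincomb (b ∷ qs) (w ∷ ws) ⊕ β · lincomb (a ∷ rs) (w ∷ ws)
      ≡⟨ cong (lincomb (b ∷ qs) (w ∷ ws) ⊕_) (sym (lincomb-* β (a ∷ rs) (w ∷ ws))) ⟩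
    lincomb (b ∷ qs) (w ∷ ws) ⊕ lincomb (Vec.map (β *ᶠ_) (a ∷ rs)) (w ∷ ws)
      ≡⟨ sym (lincomb-+ (b ∷ qs) _ (w ∷ ws)) ⟩
    lincomb ((b +ᶠ β *ᶠ a) ∷ cs) (w ∷ ws)
      ≡⟨ cong (λ c → lincomb (c ∷ cs) (w ∷ ws)) (cancel-coefficient aa⁻¹ b) ⟩
    lincomb (0# ∷ cs) (w ∷ ws)
      ≡⟨ lincomb-0∷ cs w ws ⟩
    lincomb cs ws ∎)
    where
    β = -ᶠ (b *ᶠ a⁻¹)
    cs = zipWith _+ᶠ_ qs (Vec.map (β *ᶠ_) rs)

  Reflects : ∀ {p q} → Vec V p → Vec V q → Set
  Reflects {p} us vs = ∀ (cs : Vec Carrier p) →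
    ∃[ cs' ] (lincomb cs us ≡ lincomb cs' vs × (All (_≡ 0#) cs' → All (_≡ 0#) cs))

  LinIndep-reflected : ∀ {p q} {us : Vec V p} {vs : Vec V q} → Reflects us vs → LinIndep vs → LinIndep us
  LinIndep-reflected refl-us ind cs e with refl-us cs
  ... | cs' , e' , zeros = zeros (ind cs' (trans (sym e') e))

  clear-generator-all : ∀ {q w} {ws : Vec V q} {a a⁻¹ rs v} → a *ᶠ a⁻¹ ≡ 1# → v ≡ lincomb (a ∷ rs) (w ∷ ws) →
    ∀ {p} (us : Vec V p) → All (InSpan (w ∷ ws)) us →
    Σ (Vec V p) λ us' → All (InSpan ws) us' × (∀ cs → ∃[ s ] (lincomb cs us' ≡ s · v ⊕ lincomb cs us))
  clear-generator-all {v = v} aa⁻¹ ev [] [] =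
    [] , [] , λ { [] → 0# , sym (lincomb-0∷ [] v []) }
  clear-generator-all {rs = rs} {v} aa⁻¹ ev (u ∷ us) (pu ∷ pus)
    with clear-generator {rs = rs} aa⁻¹ ev pu | clear-generator-all {rs = rs} aa⁻¹ ev us pus
  ... | β , pu' | us' , pus' , comb = (u ⊕ β · v) ∷ us' , pu' ∷ pus' , combine
    where
    combine : ∀ cs → ∃[ s ] (lincomb cs ((u ⊕ β · v) ∷ us') ≡ s · v ⊕ lincomb cs (u ∷ us))
    combine (c ∷ cs) with comb cs
    ... | s , e = c *ᶠ β +ᶠ s , (begin
      c · (u ⊕ β · v) ⊕ lincomb cs us'
        ≡⟨ cong₂ _⊕_ (trans (·-distribˡ c u _) (cong (c · u ⊕_) (sym (·-assoc c β v)))) e ⟩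
      (c · u ⊕ (c *ᶠ β) · v) ⊕ (s · v ⊕ lincomb cs us)
        ≡⟨ cong (_⊕ (s · v ⊕ lincomb cs us)) (⊕-comm (c · u) _) ⟩
      ((c *ᶠ β) · v ⊕ c · u) ⊕ (s · v ⊕ lincomb cs us)
        ≡⟨ ⊕-interchange _ _ _ _ ⟩
      ((c *ᶠ β) · v ⊕ s · v) ⊕ (c · u ⊕ lincomb cs us)
        ≡⟨ cong (_⊕ (c · u ⊕ lincomb cs us)) (sym (·-distribʳ (c *ᶠ β) s v)) ⟩
      (c *ᶠ β +ᶠ s) · v ⊕ (c · u ⊕ lincomb cs us) ∎)

  drop-generator : ∀ {q p} w (ws : Vec V q) (vs : Vec V (suc p)) → All (InSpan (w ∷ ws)) vs →
                   Σ (Vec V p) λ us → All (InSpan ws) us × Reflects us vs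
  drop-generator w ws (v ∷ vs) ((a ∷ rs , ev) ∷ ps) with a ≟ᶠ 0#
  ... | no a≢0 with inverse a a≢0
  ...   | a⁻¹ , aa⁻¹ with clear-generator-all {rs = rs} aa⁻¹ ev vs ps
  ...     | us , pus , comb = us , pus , λ cs → let (s , e) = comb cs in
                                                 s ∷ cs , e , λ { (_ ∷ zs) → zs }
  drop-generator w ws (v ∷ []) _ | yes a≡0 =
    [] , [] , λ { [] → 0# ∷ [] , sym (lincomb-0∷ [] v []) , λ _ → [] }
  drop-generator w ws (v ∷ u ∷ vs) ((a ∷ rs , ev) ∷ ps) | yes a≡0 with drop-generator w ws (u ∷ vs) ps
  ... | us , pus , comb = v ∷ us , (rs , v∈ws) ∷ pus , extend-comb
    where
    v∈ws : v ≡ lincomb rs ws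
    v∈ws = trans ev (trans (cong (λ z → lincomb (z ∷ rs) (w ∷ ws)) a≡0) (lincomb-0∷ rs w ws))
    extend-comb : Reflects (v ∷ us) (v ∷ u ∷ vs)
    extend-comb (c ∷ cs) with comb cs
    ... | cs' , e , zs = c ∷ cs' , cong (c · v ⊕_) e , λ { (c≡0 ∷ zs') → c≡0 ∷ zs zs' }

  LinIndep-length≤ : ∀ {q p} (ws : Vec V q) (vs : Vec V p) → All (InSpan ws) vs → LinIndep vs → p ≤ q
  LinIndep-length≤ ws        []       _                     _   = z≤n
  LinIndep-length≤ []        (v ∷ vs) (([] , v≡0V) ∷ _) ind with ind (1# ∷ replicate _ 0#) (begin
    1# · v ⊕ lincomb (replicate _ 0#) vs
      ≡⟨ cong₂ _⊕_ (trans (·-identityˡ v) v≡0V) (lincomb-zeros vs) ⟩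
    0V ⊕ 0V
      ≡⟨ ⊕-identityˡ 0V ⟩
    0V ∎)
  ... | 1≡0 ∷ _ = ⊥-elim (0≢1 (sym 1≡0))
  LinIndep-length≤ (w ∷ ws) (v ∷ vs) ps ind with drop-generator w ws (v ∷ vs) ps
  ... | us , pus , refl-us = s≤s (LinIndep-length≤ ws us pus (LinIndep-reflected refl-us ind))

  LinIndep-∷ : ∀ {r} {E : Vec V r} {b} → LinIndep E → ¬ InSpan E b → LinIndep (b ∷ E)
  LinIndep-∷ {E = E} {b} ind b∉E (c ∷ cs) e with c ≟ᶠ 0#
  ... | yes c≡0 = c≡0 ∷ ind cs (begin
    lincomb cs E              ≡⟨ sym (lincomb-0∷ cs b E) ⟩
    lincomb (0# ∷ cs) (b ∷ E) ≡⟨ cong (λ z → lincomb (z ∷ cs) (b ∷ E)) (sym c≡0) ⟩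
    lincomb (c ∷ cs) (b ∷ E)  ≡⟨ e ⟩
    0V                        ∎)
  ... | no c≢0 with inverse c c≢0
  ...   | c⁻¹ , cc⁻¹ = ⊥-elim (b∉E (Vec.map ((c⁻¹ *ᶠ -ᶠ 1#) *ᶠ_) cs , (begin
    b
      ≡⟨ sym (·-identityˡ b) ⟩
    1# · b
      ≡⟨ cong (_· b) (sym (trans (*-comm c⁻¹ c) cc⁻¹)) ⟩
    (c⁻¹ *ᶠ c) · b
      ≡⟨ ·-assoc c⁻¹ c b ⟩
    c⁻¹ · (c · b)
      ≡⟨ cong (c⁻¹ ·_) (⊕≡0⇒≡⊖ (c · b) (lincomb cs E) e) ⟩
    c⁻¹ · (⊖ lincomb cs E)
      ≡⟨ sym (·-assoc c⁻¹ (-ᶠ 1#) _) ⟩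
    (c⁻¹ *ᶠ -ᶠ 1#) · lincomb cs E
      ≡⟨ sym (lincomb-* _ cs E) ⟩
    lincomb (Vec.map ((c⁻¹ *ᶠ -ᶠ 1#) *ᶠ_) cs) E ∎)))

  extend-LinIndep : ∀ {r} {E : Vec V r} → LinIndep E → (P : V → Set) → ∀ {r'} (bs : Vec V r') → All P bs →
    Σ ℕ λ j → Σ (Vec V j) λ g → LinIndep (g ++ E) × All (InSpan (g ++ E)) bs × All P g
  extend-LinIndep ind P []       []         = 0 , [] , ind , [] , []
  extend-LinIndep ind P (b ∷ bs) (pb ∷ pbs) with extend-LinIndep ind P bs pbs
  ... | j , g , ind' , bs∈span , pg with InSpan? (g ++ _) b
  ...   | yes b∈span = j , g , ind' , b∈span ∷ bs∈span , pg
  ...   | no  b∉span = suc j , b ∷ g , LinIndep-∷ ind' b∉span ,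
                       InSpan-head _ b ∷ All.map (InSpan-∷ _ b) bs∈span , pb ∷ pg

  lincomb-padRight : ∀ {j d} (j≤d : j ≤ d) (cs : Vec Carrier j) (g : Vec V j) →
                     lincomb (Vec.padRight j≤d 0# cs) (Vec.padRight j≤d 0V g) ≡ lincomb cs g
  lincomb-padRight {d = d} z≤n [] [] = lincomb-zeros (replicate d 0V)
  lincomb-padRight (s≤s j≤d) (c ∷ cs) (x ∷ g) = cong (c · x ⊕_) (lincomb-padRight j≤d cs g)

  complement : (W W' : V → Set) → (∀ v → W v → W' v) → ∀ {r r'} → HasDim W r → HasDim W' r' →
    Σ (Vec V (r' ∸ r)) λ g → All W' g × (∀ v → W' v → ∃[ λs ] InTranslate W (lincomb λs g) v)
  complement W W' W⊆W' {r} {r'} (bs , bs-indep , W≡span) (bs' , _ , W'≡span)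
    with extend-LinIndep bs-indep W' bs' (All.map (λ {b} → Equivalence.from (W'≡span b)) (InSpan-self bs'))
  ... | j , g , indep , bs'∈span , g⊆W' = Vec.padRight j≤d 0V g , All-padRight j≤d 0V∈W' g⊆W' , decompose
    where
    W'→span : ∀ {v} → W' v → InSpan bs' v
    W'→span {v} = Equivalence.to (W'≡span v)
    span→W : ∀ {v} → InSpan bs v → W v
    span→W {v} = Equivalence.from (W≡span v)
    0V∈W' : W' 0V
    0V∈W' = Equivalence.from (W'≡span 0V) (InSpan-0V bs')
    j+r≤r' : j + r ≤ r'
    j+r≤r' = LinIndep-length≤ bs' (g ++ bs)
      (++⁺ (All.map W'→span g⊆W') (All.map (λ {b} s → W'→span (W⊆W' b (span→W s))) (InSpan-self bs)))
      indep
    j≤d : j ≤ r' ∸ r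
    j≤d = subst (_≤ r' ∸ r) (m+n∸n≡m j r) (∸-monoˡ-≤ r j+r≤r')
    decompose : ∀ v → W' v → ∃[ λs ] InTranslate W (lincomb λs (Vec.padRight j≤d 0V g)) v
    decompose v v∈W' with W'→span v∈W'
    ... | cs , ev with InSpan-lincomb (g ++ bs) cs bs'∈span
    ...   | cs₂ , e₂ with Vec.splitAt j cs₂
    ...     | c₁ , c₂ , refl = Vec.padRight j≤d 0# c₁ , lincomb c₂ bs , span→W (c₂ , refl) , (begin
      v
        ≡⟨ trans ev e₂ ⟩
      lincomb (c₁ ++ c₂) (g ++ bs)
        ≡⟨ lincomb-++ c₁ c₂ g bs ⟩
      lincomb c₁ g ⊕ lincomb c₂ bs
        ≡⟨ ⊕-comm _ _ ⟩
      lincomb c₂ bs ⊕ lincomb c₁ g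
        ≡⟨ cong (lincomb c₂ bs ⊕_) (sym (lincomb-padRight j≤d c₁ g)) ⟩
      lincomb c₂ bs ⊕ lincomb (Vec.padRight j≤d 0# c₁) (Vec.padRight j≤d 0V g) ∎)

module Translates (F : FiniteField) (n : ℕ) where
  open Scheme F n
  open FiniteField F using () renaming (_*_ to _*ᶠ_)
  open Coordinatewise F
  open LinearCombinations F n
  open Dimension F n using (complement)
  open ≡-Reasoning

  module _ {W W' : V → Set} (W-sub : IsSubspace W) (W'-sub : IsSubspace W') (W⊆W' : ∀ v → W v → W' v)
           (S : V → Set) (t : ℕ) where
    private
      W⁰ : W 0V
      W⁰ = proj₁ W-sub
      W⁺ : ∀ u v → W u → W v → W (u ⊕ v)
      W⁺ = proj₁ (proj₂ W-sub)
      W· : ∀ c v → W v → W (c · v)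
      W· = proj₂ (proj₂ W-sub)
      W'⁰ : W' 0V
      W'⁰ = proj₁ W'-sub
      W'⁺ : ∀ u v → W' u → W' v → W' (u ⊕ v)
      W'⁺ = proj₁ (proj₂ W'-sub)
      W'· : ∀ c v → W' v → W' (c · v)
      W'· = proj₂ (proj₂ W'-sub)

    sumset-coordinates : ∀ {d} (g : Vec V d) → All W' g → All (InSubspacePlusSumset W S t) g →
      Σ (Vec V (d * t)) λ x → All S x × Σ (Vec Carrier d → Vec Carrier (d * t)) λ μ →
        (∀ λs → InTranslate W (lincomb (μ λs) x) (lincomb λs g)) × (∀ λs → W' (lincomb (μ λs) x))
    sumset-coordinates [] [] [] =
      [] , [] , (λ _ → []) , (λ { [] → 0V , W⁰ , sym (⊕-identityˡ 0V) }) , λ _ → W'⁰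
    sumset-coordinates (g₀ ∷ g) (g₀∈W' ∷ g⊆W') ((w₀ , u₀ , w₀∈W , (a₀ , s₀ , s₀∈S , u₀≡) , g₀≡) ∷ gs)
      with sumset-coordinates g g⊆W' gs
    ... | x , x∈S , μ , split , μ∈W' = s₀ ++ x , ++⁺ s₀∈S x∈S , μ' , split' , μ'∈W'
      where
      μ' : Vec Carrier _ → Vec Carrier _
      μ' (λ₀ ∷ λs) = Vec.map (λ₀ *ᶠ_) a₀ ++ μ λs
      lincomb-μ' : ∀ λ₀ λs → lincomb (μ' (λ₀ ∷ λs)) (s₀ ++ x) ≡ λ₀ · u₀ ⊕ lincomb (μ λs) x
      lincomb-μ' λ₀ λs = trans (lincomb-++ (Vec.map (λ₀ *ᶠ_) a₀) (μ λs) s₀ x)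
        (cong (_⊕ lincomb (μ λs) x) (trans (lincomb-* λ₀ a₀ s₀) (cong (λ₀ ·_) (sym u₀≡))))
      u₀∈W' : W' u₀
      u₀∈W' = subst W' u₀-as-difference (W'⁺ _ _ g₀∈W' (W'· _ _ (W⊆W' _ w₀∈W)))
        where
        u₀-as-difference : g₀ ⊕ ⊖ w₀ ≡ u₀
        u₀-as-difference = begin
          g₀ ⊕ ⊖ w₀          ≡⟨ cong (_⊕ ⊖ w₀) (trans g₀≡ (⊕-comm w₀ u₀)) ⟩
          (u₀ ⊕ w₀) ⊕ ⊖ w₀   ≡⟨ ⊕-assoc u₀ w₀ _ ⟩
          u₀ ⊕ (w₀ ⊕ ⊖ w₀)   ≡⟨ cong (u₀ ⊕_) (⊕-inverseʳ w₀) ⟩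
          u₀ ⊕ 0V            ≡⟨ ⊕-identityʳ u₀ ⟩
          u₀                 ∎
      split' : ∀ λs → InTranslate W (lincomb (μ' λs) (s₀ ++ x)) (lincomb λs (g₀ ∷ g))
      split' (λ₀ ∷ λs) with split λs
      ... | w , w∈W , e = λ₀ · w₀ ⊕ w , W⁺ _ _ (W· _ _ w₀∈W) w∈W , (begin
        λ₀ · g₀ ⊕ lincomb λs g
          ≡⟨ cong₂ _⊕_ (trans (cong (λ₀ ·_) g₀≡) (·-distribˡ λ₀ w₀ u₀)) e ⟩
        (λ₀ · w₀ ⊕ λ₀ · u₀) ⊕ (w ⊕ lincomb (μ λs) x)
          ≡⟨ ⊕-interchange _ _ _ _ ⟩
        (λ₀ · w₀ ⊕ w) ⊕ (λ₀ · u₀ ⊕ lincomb (μ λs) x)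
          ≡⟨ cong ((λ₀ · w₀ ⊕ w) ⊕_) (sym (lincomb-μ' λ₀ λs)) ⟩
        (λ₀ · w₀ ⊕ w) ⊕ lincomb (μ' (λ₀ ∷ λs)) (s₀ ++ x) ∎)
      μ'∈W' : ∀ λs → W' (lincomb (μ' λs) (s₀ ++ x))
      μ'∈W' (λ₀ ∷ λs) = subst W' (sym (lincomb-μ' λ₀ λs)) (W'⁺ _ _ (W'· _ _ u₀∈W') (μ∈W' λs))

    translates-cover : ∀ {r r'} → HasDim W r → HasDim W' r' → (∀ v → W' v → InSubspacePlusSumset W S t v) →
      Σ (Vec V ((r' ∸ r) * t)) λ x → All S x × Σ (Vec Carrier (r' ∸ r) → Vec Carrier ((r' ∸ r) * t)) λ μ →
        ∀ v → W' v ⇔ (∃[ λs ] InTranslate W (lincomb (μ λs) x) v)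
    translates-cover dimW dimW' W'⊆W+tFS with complement W W' W⊆W' dimW dimW'
    ... | g , g⊆W' , W'⊆W+⟨g⟩ with sumset-coordinates g g⊆W' (All.map (λ {v} → W'⊆W+tFS v) g⊆W')
    ... | x , x∈S , μ , split , μ∈W' = x , x∈S , μ , λ v → mk⇔ (to v) from
      where
      to : ∀ v → W' v → ∃[ λs ] InTranslate W (lincomb (μ λs) x) v
      to v v∈W' with W'⊆W+⟨g⟩ v v∈W'
      ... | λs , w , w∈W , ev with split λs
      ...   | w₂ , w₂∈W , e₂ = λs , w ⊕ w₂ , W⁺ _ _ w∈W w₂∈W ,
                                trans ev (trans (cong (w ⊕_) e₂) (sym (⊕-assoc w w₂ _)))
      from : ∀ {v} → ∃[ λs ] InTranslate W (lincomb (μ λs) x) v → W' v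
      from (λs , w , w∈W , refl) = W'⁺ _ _ (W⊆W' _ w∈W) (μ∈W' λs)

module CoordinateMaps (F : FiniteField) (n : ℕ) where
  open Scheme F n
  open Coordinatewise F using (⊕-identityʳ; ·-identityˡ)
  open LinearCombinations F n using (lincomb-zeros; lincomb-0∷)

  fromColumns : ∀ {k k'} → (Fin k' → Vec Carrier k) → Coeff k k'
  fromColumns col = tabulate (λ i → tabulate (λ j → lookup (col j) i))

  apply-fromColumns : ∀ {k k'} (col : Fin k' → Vec Carrier k) x →
                      apply (fromColumns col) x ≡ tabulate (λ j → lincomb (col j) x)
  apply-fromColumns col x = tabulate-cong λ j → cong (λ cs → lincomb cs x) (trans
    (tabulate-cong λ i → trans (cong (λ row → lookup row j) (lookup∘tabulate _ i)) (lookup∘tabulate _ j))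
    (tabulate∘lookup (col j)))

  unit : ∀ {k} → Fin k → Vec Carrier k
  unit zero    = 1# ∷ replicate _ 0#
  unit (suc i) = 0# ∷ unit i

  lincomb-unit : ∀ {k} (i : Fin k) (x : Vec V k) → lincomb (unit i) x ≡ lookup x i
  lincomb-unit zero    (v ∷ x) = trans (cong₂ _⊕_ (·-identityˡ v) (lincomb-zeros x)) (⊕-identityʳ v)
  lincomb-unit (suc i) (v ∷ x) = trans (lincomb-0∷ (unit i) v x) (lincomb-unit i x)

  select : ∀ {k k'} → Vec (Fin k) k' → Coeff k k'
  select is = fromColumns (unit ∘ lookup is)

  apply-select : ∀ {k k'} (is : Vec (Fin k) k') x → apply (select is) x ≡ Vec.map (lookup x) is
  apply-select is x = begin
    apply (select is) x
      ≡⟨ apply-fromColumns (unit ∘ lookup is) x ⟩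
    tabulate (λ j → lincomb (unit (lookup is j)) x)
      ≡⟨ tabulate-cong (λ j → lincomb-unit (lookup is j) x) ⟩
    tabulate (lookup x ∘ lookup is)
      ≡⟨ tabulate-∘ (lookup x) (lookup is) ⟩
    Vec.map (lookup x) (tabulate (lookup is))
      ≡⟨ cong (Vec.map (lookup x)) (tabulate∘lookup is) ⟩
    Vec.map (lookup x) is ∎
    where open ≡-Reasoning

  linearForm : ∀ {k} → Vec Carrier k → Coeff k 1
  linearForm cs = fromColumns (λ _ → cs)

  apply-linearForm : ∀ {k} (cs : Vec Carrier k) x → apply (linearForm cs) x ≡ lincomb cs x ∷ []
  apply-linearForm cs x = apply-fromColumns (λ _ → cs) x

  -- apply c x reduces to lincomb (coefficients c) x ∷ [].
  coefficients : ∀ {k} → Coeff k 1 → Vec Carrier k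
  coefficients c = tabulate (λ i → lookup (lookup c i) zero)

module Restriction (F : FiniteField) (n : ℕ) where
  open Scheme F n
  open CoordinateMaps F n using (select; apply-select)

  module _ (D k : ℕ) where
    outer : Vec (Fin (D + (k + D))) D
    outer = Vec.map (_↑ˡ (k + D)) (Vec.allFin D)

    middle : Vec (Fin (D + (k + D))) k
    middle = Vec.map (D ↑ʳ_) (Vec.map (_↑ˡ D) (Vec.allFin k))

    copyOuter : Coeff (D + (k + D)) (D + (k + D))
    copyOuter = select (outer ++ (middle ++ outer))

    projectMiddle : Coeff (D + (k + D)) k
    projectMiddle = select middle

    module _ (p : Vec V D) (y : Vec V k) (z : Vec V D) where
      lookup-outer : Vec.map (lookup (p ++ (y ++ z))) outer ≡ p
      lookup-outer = trans (map-lookup-↑ˡ p (y ++ z) _) (map-lookup-allFin p)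

      lookup-middle : Vec.map (lookup (p ++ (y ++ z))) middle ≡ y
      lookup-middle = trans (map-lookup-↑ʳ p (y ++ z) _)
                     (trans (map-lookup-↑ˡ y z _) (map-lookup-allFin y))

      apply-copyOuter : apply copyOuter (p ++ (y ++ z)) ≡ p ++ (y ++ p)
      apply-copyOuter = begin
        apply copyOuter (p ++ (y ++ z))
          ≡⟨ apply-select _ _ ⟩
        Vec.map f (outer ++ (middle ++ outer))
          ≡⟨ map-++ f outer _ ⟩
        Vec.map f outer ++ Vec.map f (middle ++ outer)
          ≡⟨ cong (Vec.map f outer ++_) (map-++ f middle outer) ⟩
        Vec.map f outer ++ (Vec.map f middle ++ Vec.map f outer)
          ≡⟨ cong₂ (λ a b → a ++ (b ++ a)) lookup-outer lookup-middle ⟩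
        p ++ (y ++ p) ∎
        where
        open ≡-Reasoning
        f = lookup (p ++ (y ++ z))

      apply-projectMiddle : apply projectMiddle (p ++ (y ++ z)) ≡ y
      apply-projectMiddle = trans (apply-select middle _) lookup-middle

  module _ (S : V → Set) (S? : ∀ v → Dec (S v)) (m : ℕ) (lab : Labels)
           (scheme : IsLinearScheme S S? m lab) where

    image≡block : ∀ {k k'} → 1 ≤ k → k ≤ m → 1 ≤ k' → k' ≤ m →
                  {b : Vec V k} → All S b → {b' : Vec V k'} → All S b' → (c : Coeff k k') →
                  InBlock S lab b' (apply c b) → ImageEq S lab b c b'
    image≡block 1≤k k≤m 1≤k' k'≤m {b} b∈S {b'} b'∈S c hit
      with proj₁ (scheme _ _ 1≤k k≤m 1≤k' k'≤m b b∈S b' b'∈S c)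
    ... | inj₁ image≡ = image≡
    ... | inj₂ disjoint = ⊥-elim (disjoint b (b∈S , refl) hit)

    restricted-block : ∀ {D k} {x : Vec V D} → All S x → 1 ≤ k → D + (k + D) ≤ m →
                       {y₀ : Vec V k} → All S y₀ → ∀ z → InBlock S (restrict lab x) (y₀ ++ x) z →
                       ∃[ y ] (z ≡ y ++ x × InBlock S lab y₀ y)
    restricted-block {D} {k} {x} x∈S 1≤k K≤m {y₀} y₀∈S z (z∈S , z∼y₀x) with Vec.splitAt k z
    ... | y , z₂ , refl = y , cong (y ++_) z₂≡x , y∼y₀
      where
      1≤K : 1 ≤ D + (k + D)
      1≤K = ≤-trans 1≤k (≤-trans (m≤m+n k D) (m≤n+m (k + D) D))
      k≤m : k ≤ m
      k≤m = ≤-trans (≤-trans (m≤m+n k D) (m≤n+m (k + D) D)) K≤m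
      b₀∈S : All S (x ++ (y₀ ++ x))
      b₀∈S = ++⁺ x∈S (++⁺ y₀∈S x∈S)
      xyz₂∼b₀ : InBlock S lab (x ++ (y₀ ++ x)) (x ++ (y ++ z₂))
      xyz₂∼b₀ = ++⁺ x∈S z∈S , z∼y₀x
      copy≡ : ImageEq S lab (x ++ (y₀ ++ x)) (copyOuter D k) (x ++ (y₀ ++ x))
      copy≡ = image≡block 1≤K K≤m 1≤K K≤m b₀∈S b₀∈S (copyOuter D k)
        (subst (InBlock S lab (x ++ (y₀ ++ x))) (sym (apply-copyOuter D k x y₀ x)) (b₀∈S , refl))
      z₂≡x : z₂ ≡ x
      z₂≡x with Equivalence.from (copy≡ (x ++ (y ++ z₂))) xyz₂∼b₀
      ... | w , _ , copy-w with Vec.splitAt D w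
      ...   | p , w' , refl with Vec.splitAt k w'
      ...     | y' , z' , refl with ++-injective p x (trans (sym (apply-copyOuter D k p y' z')) copy-w)
      ...       | p≡x , y'p≡yz₂ = trans (sym (++-injectiveʳ y' y y'p≡yz₂)) p≡x
      y∼y₀ : InBlock S lab y₀ y
      y∼y₀ = Equivalence.to
        (image≡block 1≤K K≤m 1≤k k≤m b₀∈S y₀∈S (projectMiddle D k)
          (subst (InBlock S lab y₀) (sym (apply-projectMiddle D k x y₀ x)) (y₀∈S , refl)) y)
        (x ++ (y ++ z₂) , xyz₂∼b₀ , apply-projectMiddle D k x y z₂)

module Constructibility (F : FiniteField) (n : ℕ) where
  open Scheme F n
  open FiniteField F using (elements)
  open LinearCombinations F n using (InTranslate; ∈-allVecs; ∈-allV^; lincomb-++)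
  open CoordinateMaps F n using (linearForm; apply-linearForm; coefficients)
  open Restriction F n using (restricted-block)

  module _ (S : V → Set) (lab : Labels) {k : ℕ} where
    Constructible-cong : ∀ {A B : V → Set} → (∀ v → A v ⇔ B v) →
                         Constructible S lab k A → Constructible S lab k B
    Constructible-cong A⇔B (L , L∈S , A⇔L) = L , L∈S , λ v → ⇔.trans (⇔.sym (A⇔B v)) (A⇔L v)

    Constructible-⋃ : ∀ {I : Set} {A : I → V → Set} (is : List I) →
                      ListAll.All (λ i → Constructible S lab k (A i)) is →
                      Constructible S lab k (λ v → Any (λ i → A i v) is)
    Constructible-⋃ List.[] ListAll.[] = List.[] , ListAll.[] , λ v → mk⇔ (λ ()) (λ ())
    Constructible-⋃ {A = A} (i List.∷ is) ((L , L∈S , A⇔L) ListAll.∷ cs) with Constructible-⋃ is cs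
    ... | L' , L'∈S , ⋃⇔L' = L List.++ L' , ListAllP.++⁺ L∈S L'∈S , λ v → mk⇔ (to v) (from v)
      where
      InImageOf : V → Vec V k × Coeff k 1 → Set
      InImageOf v (b , c) = InImage S lab b c v
      to : ∀ v → Any (λ i → A i v) (i List.∷ is) → Any (InImageOf v) (L List.++ L')
      to v (here a)  = AnyP.++⁺ˡ (Equivalence.to (A⇔L v) a)
      to v (there a) = AnyP.++⁺ʳ L (Equivalence.to (⋃⇔L' v) a)
      from : ∀ v → Any (InImageOf v) (L List.++ L') → Any (λ i → A i v) (i List.∷ is)
      from v p with AnyP.++⁻ L p
      ... | inj₁ q = here (Equivalence.from (A⇔L v) q)
      ... | inj₂ q = there (Equivalence.from (⋃⇔L' v) q)

    Constructible-∃ : ∀ {d} {A : Vec Carrier d → V → Set} → (∀ λs → Constructible S lab k (A λs)) →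
                      Constructible S lab k (λ v → ∃[ λs ] A λs v)
    Constructible-∃ {d} A-constr = Constructible-cong
      (λ v → mk⇔ (λ p → let (λs , _ , a) = find p in λs , a) (λ (λs , a) → lose (∈-allVecs λs) a))
      (Constructible-⋃ (allVecs d elements) (ListAll.universal A-constr _))

  apply-linearForm-++ : ∀ {k D} (cs : Vec Carrier k) (μ : Vec Carrier D) y x →
                        apply (linearForm (cs ++ μ)) (y ++ x) ≡ (lincomb cs y ⊕ lincomb μ x) ∷ []
  apply-linearForm-++ cs μ y x =
    trans (apply-linearForm (cs ++ μ) (y ++ x)) (cong (_∷ []) (lincomb-++ cs μ y x))

  module _ (S : V → Set) (S? : ∀ v → Dec (S v)) (m : ℕ) (lab : Labels) (scheme : IsLinearScheme S S? m lab)
           {D k : ℕ} {x : Vec V D} (x∈S : All S x) (1≤k : 1 ≤ k) (K≤m : D + (k + D) ≤ m) where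

    translate-image-constructible : (b : Vec V k) → All S b → (c : Coeff k 1) → (μ : Vec Carrier D) →
      Constructible S (restrict lab x) (k + D) (InTranslate (InImage S lab b c) (lincomb μ x))
    translate-image-constructible b b∈S c μ = List.map entry B , reps∈S , λ v → mk⇔ (to v) (from v)
      where
      B = List.filter (inBlock? S S? lab b) (allV^ k)
      entry : Vec V k → Vec V (k + D) × Coeff (k + D) 1
      entry y₀ = y₀ ++ x , linearForm (coefficients c ++ μ)
      InImageOf : V → Vec V (k + D) × Coeff (k + D) 1 → Set
      InImageOf v (b' , c') = InImage S (restrict lab x) b' c' v
      reps∈S : ListAll.All (λ p → All S (proj₁ p)) (List.map entry B)
      reps∈S = ListAllP.map⁺
        (ListAll.map (λ y₀∼b → ++⁺ (proj₁ y₀∼b) x∈S) (ListAllP.all-filter (inBlock? S S? lab b) (allV^ k)))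
      to : ∀ v → InTranslate (InImage S lab b c) (lincomb μ x) v → Any (InImageOf v) (List.map entry B)
      to v (w , (y , y∼b , cy≡w) , v≡) =
        lose (∈-map⁺ entry (∈-filter⁺ (inBlock? S S? lab b) (∈-allV^ y) y∼b))
          (y ++ x , (++⁺ (proj₁ y∼b) x∈S , refl) ,
           trans (apply-linearForm-++ (coefficients c) μ y x)
                 (cong (_∷ []) (trans (cong (_⊕ lincomb μ x) (∷-injectiveˡ cy≡w)) (sym v≡))))
      from : ∀ v → Any (InImageOf v) (List.map entry B) → InTranslate (InImage S lab b c) (lincomb μ x) v
      from v p with find (AnyP.map⁻ p)
      ... | y₀ , y₀∈B , (z , z∼y₀x , ez) with ∈-filter⁻ (inBlock? S S? lab b) {xs = allV^ k} y₀∈B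
      ...   | _ , y₀∼b with restricted-block S S? m lab scheme x∈S 1≤k K≤m (proj₁ y₀∼b) z z∼y₀x
      ...     | y , refl , y∼y₀ =
        lincomb (coefficients c) y , (y , (proj₁ y∼y₀ , trans (proj₂ y∼y₀) (proj₂ y₀∼b)) , refl) ,
        sym (∷-injectiveˡ (trans (sym (apply-linearForm-++ (coefficients c) μ y x)) ez))

    translate-constructible : ∀ {W} → Constructible S lab k W → (μ : Vec Carrier D) →
                              Constructible S (restrict lab x) (k + D) (InTranslate W (lincomb μ x))
    translate-constructible {W} (L , L∈S , W⇔L) μ = Constructible-cong S (restrict lab x)
      (λ v → mk⇔ (to v) (from v))
      (Constructible-⋃ S (restrict lab x) L (ListAll.map (λ {p} → images-constructible {p}) L∈S))
      where
      InTranslateOf : V → Vec V k × Coeff k 1 → Set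
      InTranslateOf v (b , c) = InTranslate (InImage S lab b c) (lincomb μ x) v
      images-constructible : ∀ {p} → All S (proj₁ p) →
        Constructible S (restrict lab x) (k + D) (λ v → InTranslateOf v p)
      images-constructible {b , c} b∈S = translate-image-constructible b b∈S c μ
      to : ∀ v → Any (InTranslateOf v) L → InTranslate W (lincomb μ x) v
      to v p with find p
      ... | _ , p∈L , (w , w∈img , v≡) = w , Equivalence.from (W⇔L w) (lose p∈L w∈img) , v≡
      from : ∀ v → InTranslate W (lincomb μ x) v → Any (InTranslateOf v) L
      from v (w , w∈W , v≡) = Any.map (λ w∈img → w , w∈img , v≡) (Equivalence.to (W⇔L w) w∈W)

lemmaD5 : (F : FiniteField) (n : ℕ) →
    let open Scheme F n in
    (S : V → Set) (S? : ∀ v → Dec (S v)) (m : ℕ) (lab : Labels) →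
    IsLinearScheme S S? m lab →
    (W W' : V → Set) → IsSubspace W → IsSubspace W' → (∀ v → W v → W' v) →
    (r r' : ℕ) → HasDim W r → HasDim W' r' →
    (k t : ℕ) → 1 ≤ k → k ≤ m →
    Constructible S lab k W →
    (∀ v → W' v → InSubspacePlusSumset W S t v) →
    k + 2 * ((r' ∸ r) * t) ≤ m →
    ∃[ x ] (All S {(r' ∸ r) * t} x ×
            Constructible S (restrict lab x) (k + (r' ∸ r) * t) W')
lemmaD5 F n S S? m lab scheme W W' W-sub W'-sub W⊆W' r r' dimW dimW' k t 1≤k _
        W-constructible W'⊆W+tFS k+2D≤m
  with Translates.translates-cover F n W-sub W'-sub W⊆W' S t dimW dimW' W'⊆W+tFS
... | x , x∈S , μ , W'≡⋃translates = x , x∈S ,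
  Constructible-cong S (restrict lab x) (λ v → ⇔.sym (W'≡⋃translates v))
    (Constructible-∃ S (restrict lab x) λ λs →
      translate-constructible S S? m lab scheme x∈S 1≤k D+k+D≤m W-constructible (μ λs))
  where
  open Scheme F n using (restrict)
  open Constructibility F n
  D = (r' ∸ r) * t
  D+k+D≤m : D + (k + D) ≤ m
  D+k+D≤m = subst (_≤ m) (sym (rearrange k D)) k+2D≤m
    where
    rearrange : ∀ k D → D + (k + D) ≡ k + 2 * D
    rearrange = solve-∀
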